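{- Let $l\ge 0$ and $n\ge 0$ be integers. Let $\mathrm{Fib}^l_n$ be the set of functions $a\colon\{0,1,\ldots,n-1\}\to\{0,1\}$ such that $a_i+a_j\le 1$ whenever $i\neq j$ and $|i-j|\le l$, and define $$\chi^l_n(z,q)=\sum_{a\in\mathrm{Fib}^l_n} z^{a_0+\cdots+a_{n-1}}\,q^{0\cdot a_0+1\cdot a_1+\cdots+(n-1)a_{n-1}}.$$ For an integer $N\ge 0$ put $$P^l_N(z,q)=\sum_{m=0}^{\lfloor N/(l+1)\rfloor} z^m\,q^{\frac{l+1}{2}m(m-1)}\begin{bmatrix}N-lm\\ m\end{bmatrix}_q .$$ Then $\chi^l_n(z,q)=P^l_{n+l}(z,q)$.
   Context: $(q)_k=\prod_{i=1}^k(1-q^i)$ for $k\ge 0$ (with $(q)_0=1$), and $\begin{bmatrix}A\\ B\end{bmatrix}_q=\frac{(q)_A}{(q)_B(q)_{A-B}}$ is the $q$-binomial coefficient for $0\le B\le A$. Here $\lfloor x\rfloor$ denotes the integer part. -}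

module Defs where

open import Data.Nat as ℕ using (ℕ; zero; suc; _∸_; ∣_-_∣)
open import Data.Nat.DivMod using (_/_)
open import Data.Fin using (Fin; toℕ)
import Data.Fin
open import Data.Fin.Properties using (all?)
import Data.Fin.Properties as FinP
import Data.Nat.Properties as ℕP
open import Data.List using (List; []; _∷_; concatMap; map; upTo; filter)
open import Data.Nat.ListAction using (sum)
import Data.List as List
open import Data.Vec.Functional using () renaming (_∷_ to _◂_)
open import Data.Rational using (ℚ; 0ℚ; 1ℚ; _+_; _*_; _-_; _÷_; ≢-nonZero)
open import Data.Rational.Properties using (_≟_)
open import Relation.Nullary using (Dec; yes; no; ¬_)
open import Relation.Nullary.Decidable using (¬?; _→-dec_)
open import Relation.Binary.PropositionalEquality using (_≡_; _≢_)

infixr 8 _^_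
_^_ : ℚ → ℕ → ℚ
x ^ zero  = 1ℚ
x ^ suc k = x * (x ^ k)

Σ : {A : Set} → List A → (A → ℚ) → ℚ
Σ xs f = List.foldr (λ x acc → f x + acc) 0ℚ xs

allFuns : (n : ℕ) → List (Fin n → Fin 2)
allFuns zero    = (λ ()) ∷ []
allFuns (suc n) = concatMap (λ f → (Data.Fin.zero ◂ f) ∷ (Data.Fin.suc Data.Fin.zero ◂ f) ∷ []) (allFuns n)

IsFib : (l n : ℕ) → (Fin n → Fin 2) → Set
IsFib l n a = ∀ i j → i ≢ j → ∣ toℕ i - toℕ j ∣ ℕ.≤ l → toℕ (a i) ℕ.+ toℕ (a j) ℕ.≤ 1

isFib? : ∀ l n a → Dec (IsFib l n a)
isFib? l n a = all? λ i → all? λ j →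
  ¬? (i FinP.≟ j) →-dec (∣ toℕ i - toℕ j ∣ ℕP.≤? l →-dec (toℕ (a i) ℕ.+ toℕ (a j) ℕP.≤? 1))

-- Fib^l_n as a list (the set, enumerated without repetition)
Fib : (l n : ℕ) → List (Fin n → Fin 2)
Fib l n = filter (isFib? l n) (allFuns n)

count : ∀ {n} → (Fin n → Fin 2) → ℕ
count {n} a = sum (map (λ i → toℕ (a i)) (List.allFin n))

wsum : ∀ {n} → (Fin n → Fin 2) → ℕ
wsum {n} a = sum (map (λ i → toℕ i ℕ.* toℕ (a i)) (List.allFin n))

χ : (l n : ℕ) → ℚ → ℚ → ℚ
χ l n z q = Σ (Fib l n) (λ a → (z ^ count a) * (q ^ wsum a))

qPoch : ℚ → ℕ → ℚ
qPoch q zero    = 1ℚ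
qPoch q (suc k) = qPoch q k * (1ℚ - q ^ suc k)

-- division, total: returns 0 when the divisor is 0
-- (never happens below under the hypothesis q ∉ {1,-1})
_⊘_ : ℚ → ℚ → ℚ
x ⊘ y with y ≟ 0ℚ
... | yes _  = 0ℚ
... | no y≢0 = _÷_ x y {{≢-nonZero y≢0}}

-- q-binomial [A B]_q = (q)_A / ((q)_B (q)_{A-B}), for 0 ≤ B ≤ A
qBinom : ℚ → ℕ → ℕ → ℚ
qBinom q A B = qPoch q A ⊘ (qPoch q B * qPoch q (A ∸ B))

P : (l N : ℕ) → ℚ → ℚ → ℚ
P l N z q = Σ (upTo (suc (N / suc l)))
  (λ m → (z ^ m) * (q ^ ((suc l ℕ.* (m ℕ.* (m ∸ 1))) / 2)) * qBinom q (N ∸ l ℕ.* m) m)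

-- Let χ^l_{k,n}(z,q) be the generating function of those a ∈ Fib^l_n that vanish on
-- {0,…,k-1}. Splitting off a₀ and shifting the remaining indices down by one (which
-- replaces z by zq) gives χ^l_{0,n+1}(z) = χ^l_{0,n}(zq) + z χ^l_{l,n}(zq) and
-- χ^l_{k+1,n+1}(z) = χ^l_{k,n}(zq). On the other side, the q-Pascal rule
-- [A+1, B+1] = [A, B] + q^{B+1} [A, B+1] applied termwise gives
-- P^l_{N+1}(z) = P^l_N(zq) + z P^l_{N-l}(zq^{l+1}) for N ≥ l, while P^l_N = 1 for N ≤ l.
-- Induction on n then yields χ^l_{k,n}(z) = P^l_{n+l-k}(zq^k). The hypothesis q ≠ ±1
-- makes every (q)_k nonzero, so the quotient defining [A, B]_q obeys the q-Pascal rule.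

module Submission where

open import Defs

-- Anonymous, so that the ℚ operations opened inside do not clash with ℕ's _+_ at the end.
module _ where

  open import Data.Empty using (⊥-elim)
  open import Data.Fin as Fin using (Fin; toℕ)
  import Data.Fin.Properties as FinP
  open import Data.List using (List; []; _∷_; _++_; map; filter; concatMap; allFin; applyUpTo)
  import Data.List.Properties as ListP
  open import Data.Nat as ℕ using (ℕ; zero; suc; _∸_; z≤n; s≤s; NonZero)
  open import Data.Nat.DivMod using (_/_; m/n*n≤m; m*n/n≡m; +-distrib-/-∣ʳ; /-monoˡ-≤; m/n≤m; m<n⇒m/n≡0)
  open import Data.Nat.Divisibility using (divides)
  open import Data.Nat.ListAction using (sum)
  import Data.Nat.Properties as ℕP
  open import Data.Nat.Tactic.RingSolver using (solve-∀)
  open import Data.Product using (_×_; _,_; proj₁)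
  open import Data.Rational using (ℚ; 0ℚ; 1ℚ; _+_; _*_; _-_; -_; 1/_; ∣_∣; _<_; NonNegative; ≢-nonZero)
  open import Data.Rational.Properties
  open import Data.Rational.Solver using (module +-*-Solver)
  open import Data.Sum using (_⊎_; inj₁; inj₂)
  open import Data.Vec.Functional using () renaming (_∷_ to _◂_)
  open import Function using (_∘_; id)
  open import Relation.Binary.Definitions using (tri<; tri≈; tri>)
  open import Relation.Binary.PropositionalEquality
  open import Relation.Nullary using (Dec; yes; no; ¬_)
  open import Relation.Nullary.Decidable using (_×-dec_; _→-dec_)
  open import Relation.Unary using (Decidable)
  open import Algebra.Apartness.Properties.HeytingCommutativeRing heytingCommutativeRing using (x#0y#0→xy#0)
  open import Algebra.Properties.CommutativeSemigroup ℕP.+-commutativeSemigroup using (interchange)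
  open import Algebra.Properties.Group +-0-group using (x∙y⁻¹≈ε⇒x≈y)
  open +-*-Solver

  ^-homo-* : ∀ x m n → x ^ (m ℕ.+ n) ≡ x ^ m * x ^ n
  ^-homo-* x zero    n = sym (*-identityˡ _)
  ^-homo-* x (suc m) n = trans (cong (x *_) (^-homo-* x m n)) (sym (*-assoc x _ _))

  ^-distrib-* : ∀ x y n → (x * y) ^ n ≡ x ^ n * y ^ n
  ^-distrib-* x y zero    = refl
  ^-distrib-* x y (suc n) = trans (cong ((x * y) *_) (^-distrib-* x y n))
    (solve 4 (λ x y a b → (x :* y) :* (a :* b) := (x :* a) :* (y :* b)) refl x y (x ^ n) (y ^ n))

  ^-assocʳ : ∀ x m n → (x ^ m) ^ n ≡ x ^ (m ℕ.* n)
  ^-assocʳ x m zero    = cong (x ^_) (sym (ℕP.*-zeroʳ m))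
  ^-assocʳ x m (suc n) = begin
    x ^ m * (x ^ m) ^ n      ≡⟨ cong (x ^ m *_) (^-assocʳ x m n) ⟩
    x ^ m * x ^ (m ℕ.* n)    ≡⟨ ^-homo-* x m (m ℕ.* n) ⟨
    x ^ (m ℕ.+ m ℕ.* n)      ≡⟨ cong (x ^_) (ℕP.*-suc m n) ⟨
    x ^ (m ℕ.* suc n)        ∎
    where open ≡-Reasoning

  ∣p^n∣≡∣p∣^n : ∀ p n → ∣ p ^ n ∣ ≡ ∣ p ∣ ^ n
  ∣p^n∣≡∣p∣^n p zero    = refl
  ∣p^n∣≡∣p∣^n p (suc n) = trans (∣p*q∣≡∣p∣*∣q∣ p (p ^ n)) (cong (∣ p ∣ *_) (∣p^n∣≡∣p∣^n p n))

  module _ {p : ℚ} .{{_ : NonNegative p}} where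

    p<1⇒p^[1+n]<1 : p < 1ℚ → ∀ n → p ^ suc n < 1ℚ
    p<1⇒p^[1+n]<1 p<1 zero    = subst (_< 1ℚ) (sym (*-identityʳ p)) p<1
    p<1⇒p^[1+n]<1 p<1 (suc n) = begin-strict
      p * p ^ suc n   ≤⟨ *-monoˡ-≤-nonNeg p (<⇒≤ (p<1⇒p^[1+n]<1 p<1 n)) ⟩
      p * 1ℚ          ≡⟨ *-identityʳ p ⟩
      p               <⟨ p<1 ⟩
      1ℚ              ∎
      where open ≤-Reasoning

    1<p⇒1<p^[1+n] : 1ℚ < p → ∀ n → 1ℚ < p ^ suc n
    1<p⇒1<p^[1+n] 1<p zero    = subst (1ℚ <_) (sym (*-identityʳ p)) 1<p
    1<p⇒1<p^[1+n] 1<p (suc n) = begin-strict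
      1ℚ              <⟨ 1<p ⟩
      p               ≡⟨ *-identityʳ p ⟨
      p * 1ℚ          ≤⟨ *-monoˡ-≤-nonNeg p (<⇒≤ (1<p⇒1<p^[1+n] 1<p n)) ⟩
      p * p ^ suc n   ∎
      where open ≤-Reasoning

    p^[1+n]≡1⇒p≡1 : ∀ n → p ^ suc n ≡ 1ℚ → p ≡ 1ℚ
    p^[1+n]≡1⇒p≡1 n p^[1+n]≡1 with <-cmp p 1ℚ
    ... | tri< p<1 _ _ = ⊥-elim (<-irrefl p^[1+n]≡1 (p<1⇒p^[1+n]<1 p<1 n))
    ... | tri≈ _ p≡1 _ = p≡1
    ... | tri> _ _ 1<p = ⊥-elim (<-irrefl (sym p^[1+n]≡1) (1<p⇒1<p^[1+n] 1<p n))

  ∣p∣≢1 : ∀ {p} → p ≢ 1ℚ → p ≢ - 1ℚ → ∣ p ∣ ≢ 1ℚ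
  ∣p∣≢1 {p} p≢1 p≢-1 ∣p∣≡1 with ∣p∣≡p∨∣p∣≡-p p
  ... | inj₁ ∣p∣≡p  = p≢1 (trans (sym ∣p∣≡p) ∣p∣≡1)
  ... | inj₂ ∣p∣≡-p = p≢-1 (neg-injective (trans (sym ∣p∣≡-p) ∣p∣≡1))

  q^[1+n]≢1 : ∀ {q} → q ≢ 1ℚ → q ≢ - 1ℚ → ∀ n → q ^ suc n ≢ 1ℚ
  q^[1+n]≢1 {q} q≢1 q≢-1 n q^[1+n]≡1 = ∣p∣≢1 q≢1 q≢-1
    (p^[1+n]≡1⇒p≡1 {{∣-∣-nonNeg q}} n (trans (sym (∣p^n∣≡∣p∣^n q (suc n))) (cong ∣_∣ q^[1+n]≡1)))

  qPoch≢0 : ∀ {q} → q ≢ 1ℚ → q ≢ - 1ℚ → ∀ k → qPoch q k ≢ 0ℚ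
  qPoch≢0 q≢1 q≢-1 zero    ()
  qPoch≢0 q≢1 q≢-1 (suc k) = x#0y#0→xy#0 (qPoch≢0 q≢1 q≢-1 k)
    (λ 1-q^[1+k]≡0 → q^[1+n]≢1 q≢1 q≢-1 k (sym (x∙y⁻¹≈ε⇒x≈y _ _ 1-q^[1+k]≡0)))

  -- q-binomial coefficients

  qPascal : ℚ → ℕ → ℕ → ℚ
  qPascal q A       zero    = 1ℚ
  qPascal q zero    (suc B) = 0ℚ
  qPascal q (suc A) (suc B) = qPascal q A B + q ^ suc B * qPascal q A (suc B)

  qPascal-< : ∀ q {A B} → A ℕ.< B → qPascal q A B ≡ 0ℚ
  qPascal-< q {zero}  {suc B} _ = refl
  qPascal-< q {suc A} {suc B} (s≤s A<B)
    rewrite qPascal-< q A<B | qPascal-< q (ℕP.m<n⇒m<1+n A<B) = trans (+-identityˡ _) (*-zeroʳ (q ^ suc B))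

  qPascal-diag : ∀ q B → qPascal q B B ≡ 1ℚ
  qPascal-diag q zero    = refl
  qPascal-diag q (suc B)
    rewrite qPascal-diag q B | qPascal-< q (ℕP.n<1+n B) | *-zeroʳ (q ^ suc B) = refl

  -- In the inductive step the instances (B, C+1) and (B+1, C) recombine through
  -- (1 - q^{B+1}) + q^{B+1} (1 - q^{C+1}) = 1 - q^{B+C+2}.
  qPascal*qPoch*qPoch≡qPoch : ∀ q B C → qPascal q (B ℕ.+ C) B * (qPoch q B * qPoch q C) ≡ qPoch q (B ℕ.+ C)
  qPascal*qPoch*qPoch≡qPoch q zero    C = trans (*-identityˡ _) (*-identityˡ _)
  qPascal*qPoch*qPoch≡qPoch q (suc B) zero
    rewrite ℕP.+-identityʳ B | qPascal-diag q (suc B) = trans (*-identityˡ _) (*-identityʳ _)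
  qPascal*qPoch*qPoch≡qPoch q (suc B) (suc C) = begin
    (a + x * b) * ((PB * (1ℚ - x)) * (PC * (1ℚ - y)))
      ≡⟨ solve 7 (λ a b x y PB PC one →
           (a :+ x :* b) :* ((PB :* (one :- x)) :* (PC :* (one :- y)))
             := (a :* (PB :* (PC :* (one :- y)))) :* (one :- x)
                  :+ x :* ((b :* ((PB :* (one :- x)) :* PC)) :* (one :- y)))
           refl a b x y PB PC 1ℚ ⟩
    (a * (PB * (PC * (1ℚ - y)))) * (1ℚ - x) + x * ((b * ((PB * (1ℚ - x)) * PC)) * (1ℚ - y))
      ≡⟨ cong₂ (λ u v → u * (1ℚ - x) + x * (v * (1ℚ - y)))
           (qPascal*qPoch*qPoch≡qPoch q B (suc C)) [B+1,C]-identity ⟩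
    R * (1ℚ - x) + x * (R * (1ℚ - y))
      ≡⟨ solve 3 (λ R x y → R :* (con 1ℚ :- x) :+ x :* (R :* (con 1ℚ :- y)) := R :* (con 1ℚ :- x :* y))
           refl R x y ⟩
    R * (1ℚ - x * y)
      ≡⟨ cong (λ t → R * (1ℚ - t)) (^-homo-* q (suc B) (suc C)) ⟨
    R * (1ℚ - q ^ suc (B ℕ.+ suc C))
      ∎
    where
    open ≡-Reasoning
    a  = qPascal q (B ℕ.+ suc C) B
    b  = qPascal q (B ℕ.+ suc C) (suc B)
    x  = q ^ suc B
    y  = q ^ suc C
    PB = qPoch q B
    PC = qPoch q C
    R  = qPoch q (B ℕ.+ suc C)
    [B+1,C]-identity : b * ((PB * (1ℚ - x)) * PC) ≡ R
    [B+1,C]-identity = subst (λ t → qPascal q t (suc B) * ((PB * (1ℚ - x)) * PC) ≡ qPoch q t)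
      (sym (ℕP.+-suc B C)) (qPascal*qPoch*qPoch≡qPoch q (suc B) C)

  *⊘-cancelʳ : ∀ x y → y ≢ 0ℚ → (x * y) ⊘ y ≡ x
  *⊘-cancelʳ x y y≢0 with y ≟ 0ℚ
  ... | yes y≡0 = ⊥-elim (y≢0 y≡0)
  ... | no  _   = begin
    (x * y) * 1/ y   ≡⟨ *-assoc x y (1/ y) ⟩
    x * (y * 1/ y)   ≡⟨ cong (x *_) (*-inverseʳ y) ⟩
    x * 1ℚ           ≡⟨ *-identityʳ x ⟩
    x                ∎
    where
    open ≡-Reasoning
    instance _ = ≢-nonZero y≢0

  qBinom≡qPascal : ∀ {q} → q ≢ 1ℚ → q ≢ - 1ℚ → ∀ {A B} → B ℕ.≤ A → qBinom q A B ≡ qPascal q A B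
  qBinom≡qPascal {q} q≢1 q≢-1 {A} {B} B≤A = begin
    qPoch q A ⊘ D                ≡⟨ cong (_⊘ D) (subst (λ t → qPascal q t B * D ≡ qPoch q t)
                                      (ℕP.m+[n∸m]≡n B≤A) (qPascal*qPoch*qPoch≡qPoch q B (A ∸ B))) ⟨
    (qPascal q A B * D) ⊘ D      ≡⟨ *⊘-cancelʳ _ D (x#0y#0→xy#0 (qPoch≢0 q≢1 q≢-1 B) (qPoch≢0 q≢1 q≢-1 (A ∸ B))) ⟩
    qPascal q A B                ∎
    where
    open ≡-Reasoning
    D = qPoch q B * qPoch q (A ∸ B)

  -- The polynomials P

  quadraticExponent : ℕ → ℕ → ℕ
  quadraticExponent l m = (suc l ℕ.* (m ℕ.* (m ∸ 1))) / 2

  quadraticExponent-zero : ∀ l → quadraticExponent l 0 ≡ 0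
  quadraticExponent-zero l rewrite ℕP.*-zeroʳ (suc l) = refl

  quadraticExponent-suc : ∀ l m → quadraticExponent l (suc m) ≡ quadraticExponent l m ℕ.+ suc l ℕ.* m
  quadraticExponent-suc l zero    rewrite ℕP.*-zeroʳ (suc l) = refl
  quadraticExponent-suc l (suc m) = begin
    (suc l ℕ.* (suc (suc m) ℕ.* suc m)) / 2
      ≡⟨ cong (_/ 2) (expand l m) ⟩
    (suc l ℕ.* (suc m ℕ.* m) ℕ.+ suc l ℕ.* suc m ℕ.* 2) / 2
      ≡⟨ +-distrib-/-∣ʳ (suc l ℕ.* (suc m ℕ.* m)) (divides (suc l ℕ.* suc m) refl) ⟩
    (suc l ℕ.* (suc m ℕ.* m)) / 2 ℕ.+ suc l ℕ.* suc m ℕ.* 2 / 2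
      ≡⟨ cong ((suc l ℕ.* (suc m ℕ.* m)) / 2 ℕ.+_) (m*n/n≡m (suc l ℕ.* suc m) 2) ⟩
    (suc l ℕ.* (suc m ℕ.* m)) / 2 ℕ.+ suc l ℕ.* suc m
      ∎
    where
    open ≡-Reasoning
    expand : ∀ l m → suc l ℕ.* (suc (suc m) ℕ.* suc m) ≡ suc l ℕ.* (suc m ℕ.* m) ℕ.+ suc l ℕ.* suc m ℕ.* 2
    expand = solve-∀

  ∑< : ℕ → (ℕ → ℚ) → ℚ
  ∑< zero    f = 0ℚ
  ∑< (suc M) f = f 0 + ∑< M (f ∘ suc)

  Σ-applyUpTo : ∀ (g : ℕ → ℕ) M (f : ℕ → ℚ) → Σ (applyUpTo g M) f ≡ ∑< M (f ∘ g)
  Σ-applyUpTo g zero    f = refl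
  Σ-applyUpTo g (suc M) f = cong (f (g 0) +_) (Σ-applyUpTo (g ∘ suc) M f)

  ∑<-cong : ∀ {M} {f g : ℕ → ℚ} → (∀ m → m ℕ.< M → f m ≡ g m) → ∑< M f ≡ ∑< M g
  ∑<-cong {zero}  f≡g = refl
  ∑<-cong {suc M} f≡g = cong₂ _+_ (f≡g 0 ℕ.z<s) (∑<-cong {M} (λ m m<M → f≡g (suc m) (s≤s m<M)))

  ∑<-vanishing-tail : ∀ {K M} (f : ℕ → ℚ) → K ℕ.≤ M → (∀ m → K ℕ.≤ m → f m ≡ 0ℚ) → ∑< M f ≡ ∑< K f
  ∑<-vanishing-tail {zero}  {zero}  f _         _ = refl
  ∑<-vanishing-tail {zero}  {suc M} f _         f≡0 = trans
    (cong₂ _+_ (f≡0 0 z≤n) (∑<-vanishing-tail {M = M} (f ∘ suc) z≤n (λ m _ → f≡0 (suc m) z≤n)))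
    (+-identityʳ 0ℚ)
  ∑<-vanishing-tail {suc K} {suc M} f (s≤s K≤M) f≡0 =
    cong (f 0 +_) (∑<-vanishing-tail (f ∘ suc) K≤M (λ m K≤m → f≡0 (suc m) (s≤s K≤m)))

  ∑<-distrib-+ : ∀ M (f g : ℕ → ℚ) → ∑< M (λ m → f m + g m) ≡ ∑< M f + ∑< M g
  ∑<-distrib-+ zero    f g = sym (+-identityʳ 0ℚ)
  ∑<-distrib-+ (suc M) f g = trans (cong (f 0 + g 0 +_) (∑<-distrib-+ M (f ∘ suc) (g ∘ suc)))
    (solve 4 (λ a b c d → (a :+ b) :+ (c :+ d) := (a :+ c) :+ (b :+ d)) refl (f 0) (g 0) _ _)

  *-distribˡ-∑< : ∀ M z (f : ℕ → ℚ) → ∑< M (λ m → z * f m) ≡ z * ∑< M f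
  *-distribˡ-∑< zero    z f = sym (*-zeroʳ z)
  *-distribˡ-∑< (suc M) z f =
    trans (cong (z * f 0 +_) (*-distribˡ-∑< M z (f ∘ suc))) (sym (*-distribˡ-+ z (f 0) _))

  m≤n/o⇒o*m≤n : ∀ {m n} o .{{_ : NonZero o}} → m ℕ.≤ n / o → o ℕ.* m ℕ.≤ n
  m≤n/o⇒o*m≤n {m} {n} o m≤n/o = begin
    o ℕ.* m         ≤⟨ ℕP.*-monoʳ-≤ o m≤n/o ⟩
    o ℕ.* (n / o)   ≡⟨ ℕP.*-comm o (n / o) ⟩
    n / o ℕ.* o     ≤⟨ m/n*n≤m n o ⟩
    n               ∎
    where open ℕP.≤-Reasoning

  o*m≤n⇒m≤n/o : ∀ {m n} o .{{_ : NonZero o}} → o ℕ.* m ℕ.≤ n → m ℕ.≤ n / o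
  o*m≤n⇒m≤n/o {m} {n} o o*m≤n = begin
    m                 ≡⟨ m*n/n≡m m o ⟨
    m ℕ.* o / o       ≤⟨ /-monoˡ-≤ o (subst (ℕ._≤ n) (ℕP.*-comm o m) o*m≤n) ⟩
    n / o             ∎
    where open ℕP.≤-Reasoning

  -- The summand of P with [A, B]_q read through the q-Pascal rule, which makes it vanish for B > A.
  pTerm : ℕ → ℕ → ℚ → ℚ → ℕ → ℚ
  pTerm l N z q m = z ^ m * q ^ quadraticExponent l m * qPascal q (N ∸ l ℕ.* m) m

  pTerm-vanishes : ∀ l N z q m → N / suc l ℕ.< m → pTerm l N z q m ≡ 0ℚ
  pTerm-vanishes l N z q (suc m) N/[1+l]<1+m =
    trans (cong (z ^ suc m * q ^ quadraticExponent l (suc m) *_) (qPascal-< q N∸l*m<m))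
          (*-zeroʳ (z ^ suc m * q ^ quadraticExponent l (suc m)))
    where
    N<[1+l]*m : N ℕ.< suc l ℕ.* suc m
    N<[1+l]*m = ℕP.≰⇒> (λ le → ℕP.<⇒≱ N/[1+l]<1+m (o*m≤n⇒m≤n/o (suc l) le))
    N∸l*m<m : N ∸ l ℕ.* suc m ℕ.< suc m
    N∸l*m<m = ℕP.m<n+o⇒m∸n<o N (l ℕ.* suc m) (subst (N ℕ.<_) (ℕP.+-comm (suc m) _) N<[1+l]*m)

  -- For k > N both truncated differences are 0, and [0, m+1] = [0, m] + q^{m+1} [0, m+1] fails only at m = 0.
  qPascal-∸ : ∀ q N k m → k ℕ.≤ N ⊎ 0 ℕ.< m →
    qPascal q (suc N ∸ k) (suc m) ≡ qPascal q (N ∸ k) m + q ^ suc m * qPascal q (N ∸ k) (suc m)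
  qPascal-∸ q N k m k≤N⊎0<m with k ℕ.≤? N | k≤N⊎0<m
  ... | yes k≤N | _ rewrite ℕP.+-∸-assoc 1 k≤N = refl
  ... | no  k≰N | inj₁ k≤N = ⊥-elim (k≰N k≤N)
  ... | no  k≰N | inj₂ 0<m
    rewrite ℕP.m≤n⇒m∸n≡0 (ℕP.≰⇒> k≰N) | ℕP.m≤n⇒m∸n≡0 (ℕP.<⇒≤ (ℕP.≰⇒> k≰N)) =
    sym (trans (cong₂ _+_ (qPascal-< q 0<m) (*-zeroʳ (q ^ suc m))) (+-identityʳ 0ℚ))

  pTerm-suc : ∀ l N z q m → l ℕ.* suc m ℕ.≤ N ⊎ 0 ℕ.< m →
    pTerm l (suc N) z q (suc m) ≡ pTerm l N (z * q) q (suc m) + z * pTerm l (N ∸ l) (z * q ^ suc l) q m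
  pTerm-suc l N z q m side = begin
    z ^ suc m * q ^ quadraticExponent l (suc m) * qPascal q (suc N ∸ l ℕ.* suc m) (suc m)
      ≡⟨ cong₂ (λ u v → z ^ suc m * u * v) q^E[1+m] (qPascal-∸ q N (l ℕ.* suc m) m side) ⟩
    (z * Z) * (E * F) * (X + Q * Y)
      ≡⟨ solve 7 (λ z Z E F Q X Y →
           (z :* Z) :* (E :* F) :* (X :+ Q :* Y) := ((z :* Z) :* Q) :* (E :* F) :* Y :+ z :* ((Z :* F) :* E :* X))
           refl z Z E F Q X Y ⟩
    ((z * Z) * Q) * (E * F) * Y + z * ((Z * F) * E * X)
      ≡⟨ cong₂ (λ u v → u * v * Y + z * ((Z * F) * E * X)) (^-distrib-* z q (suc m)) q^E[1+m] ⟨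
    (z * q) ^ suc m * q ^ quadraticExponent l (suc m) * Y + z * ((Z * F) * E * X)
      ≡⟨ cong₂ (λ u v → (z * q) ^ suc m * q ^ quadraticExponent l (suc m) * Y + z * (u * E * qPascal q v m))
           [zq^[1+l]]^m≡Z*F N∸l∸l*m≡A ⟨
    (z * q) ^ suc m * q ^ quadraticExponent l (suc m) * Y
      + z * ((z * q ^ suc l) ^ m * E * qPascal q (N ∸ l ∸ l ℕ.* m) m)
      ∎
    where
    open ≡-Reasoning
    A = N ∸ l ℕ.* suc m
    Z = z ^ m
    E = q ^ quadraticExponent l m
    F = q ^ (suc l ℕ.* m)
    Q = q ^ suc m
    X = qPascal q A m
    Y = qPascal q A (suc m)
    q^E[1+m] : q ^ quadraticExponent l (suc m) ≡ E * F
    q^E[1+m] = trans (cong (q ^_) (quadraticExponent-suc l m)) (^-homo-* q (quadraticExponent l m) (suc l ℕ.* m))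
    [zq^[1+l]]^m≡Z*F : (z * q ^ suc l) ^ m ≡ Z * F
    [zq^[1+l]]^m≡Z*F = trans (^-distrib-* z (q ^ suc l) m) (cong (Z *_) (^-assocʳ q (suc l) m))
    N∸l∸l*m≡A : N ∸ l ∸ l ℕ.* m ≡ A
    N∸l∸l*m≡A = trans (ℕP.∸-+-assoc N l (l ℕ.* m)) (cong (N ∸_) (sym (ℕP.*-suc l m)))

  ∑<-pTerm-suc : ∀ l N z q M → l ℕ.≤ N →
    ∑< (suc M) (pTerm l (suc N) z q) ≡ ∑< (suc M) (pTerm l N (z * q) q) + z * ∑< M (pTerm l (N ∸ l) (z * q ^ suc l) q)
  ∑<-pTerm-suc l N z q M l≤N = begin
    T₀ + ∑< M (pTerm l (suc N) z q ∘ suc)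
      ≡⟨ cong (T₀ +_) (∑<-cong {M} (λ m _ → pTerm-suc l N z q m (side m))) ⟩
    T₀ + ∑< M (λ m → pTerm l N (z * q) q (suc m) + z * pTerm l (N ∸ l) w q m)
      ≡⟨ cong (T₀ +_) (∑<-distrib-+ M (pTerm l N (z * q) q ∘ suc) (λ m → z * pTerm l (N ∸ l) w q m)) ⟩
    T₀ + (∑< M (pTerm l N (z * q) q ∘ suc) + ∑< M (λ m → z * pTerm l (N ∸ l) w q m))
      ≡⟨ cong (λ t → T₀ + (∑< M (pTerm l N (z * q) q ∘ suc) + t)) (*-distribˡ-∑< M z (pTerm l (N ∸ l) w q)) ⟩
    T₀ + (∑< M (pTerm l N (z * q) q ∘ suc) + z * ∑< M (pTerm l (N ∸ l) w q))
      ≡⟨ +-assoc T₀ _ _ ⟨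
    ∑< (suc M) (pTerm l N (z * q) q) + z * ∑< M (pTerm l (N ∸ l) w q)
      ∎
    where
    open ≡-Reasoning
    w = z * q ^ suc l
    -- equally the 0-th summand on the left: it does not depend on N or z
    T₀ = pTerm l N (z * q) q 0
    side : ∀ m → l ℕ.* suc m ℕ.≤ N ⊎ 0 ℕ.< m
    side zero    = inj₁ (subst (ℕ._≤ N) (sym (ℕP.*-identityʳ l)) l≤N)
    side (suc m) = inj₂ ℕ.z<s

  module _ {q : ℚ} (q≢1 : q ≢ 1ℚ) (q≢-1 : q ≢ - 1ℚ) where

    P≡∑<pTerm : ∀ l N z {M} → N / suc l ℕ.< M → P l N z q ≡ ∑< M (pTerm l N z q)
    P≡∑<pTerm l N z {M} N/[1+l]<M = begin
      P l N z q
        ≡⟨ Σ-applyUpTo id (suc (N / suc l)) summand ⟩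
      ∑< (suc (N / suc l)) summand
        ≡⟨ ∑<-cong (λ m m≤N/[1+l] → cong (z ^ m * q ^ quadraticExponent l m *_)
             (qBinom≡qPascal q≢1 q≢-1 (m≤N∸l*m (ℕ.s≤s⁻¹ m≤N/[1+l])))) ⟩
      ∑< (suc (N / suc l)) (pTerm l N z q)
        ≡⟨ ∑<-vanishing-tail (pTerm l N z q) N/[1+l]<M (λ m → pTerm-vanishes l N z q m) ⟨
      ∑< M (pTerm l N z q)
        ∎
      where
      open ≡-Reasoning
      summand : ℕ → ℚ
      summand m = z ^ m * q ^ quadraticExponent l m * qBinom q (N ∸ l ℕ.* m) m
      m≤N∸l*m : ∀ {m} → m ℕ.≤ N / suc l → m ℕ.≤ N ∸ l ℕ.* m
      m≤N∸l*m {m} m≤N/[1+l] = ℕP.m+n≤o⇒m≤o∸n m (m≤n/o⇒o*m≤n (suc l) m≤N/[1+l])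

    P-suc : ∀ l N z → l ℕ.≤ N → P l (suc N) z q ≡ P l N (z * q) q + z * P l (N ∸ l) (z * q ^ suc l) q
    P-suc l N z l≤N = begin
      P l (suc N) z q
        ≡⟨ P≡∑<pTerm l (suc N) z (s≤s (m/n≤m (suc N) (suc l))) ⟩
      ∑< (suc (suc N)) (pTerm l (suc N) z q)
        ≡⟨ ∑<-pTerm-suc l N z q (suc N) l≤N ⟩
      ∑< (suc (suc N)) (pTerm l N (z * q) q) + z * ∑< (suc N) (pTerm l (N ∸ l) (z * q ^ suc l) q)
        ≡⟨ cong₂ (λ u v → u + z * v)
             (P≡∑<pTerm l N (z * q) (s≤s (ℕP.m≤n⇒m≤1+n (m/n≤m N (suc l)))))
             (P≡∑<pTerm l (N ∸ l) (z * q ^ suc l) (s≤s (ℕP.≤-trans (m/n≤m (N ∸ l) (suc l)) (ℕP.m∸n≤m N l)))) ⟨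
      P l N (z * q) q + z * P l (N ∸ l) (z * q ^ suc l) q
        ∎
      where open ≡-Reasoning

    P≡1 : ∀ l N z → N ℕ.≤ l → P l N z q ≡ 1ℚ
    P≡1 l N z N≤l = begin
      P l N z q
        ≡⟨ P≡∑<pTerm l N z (s≤s (ℕP.≤-reflexive (m<n⇒m/n≡0 (s≤s N≤l)))) ⟩
      1ℚ * q ^ quadraticExponent l 0 * 1ℚ + 0ℚ
        ≡⟨ cong (λ e → 1ℚ * q ^ e * 1ℚ + 0ℚ) (quadraticExponent-zero l) ⟩
      1ℚ
        ∎
      where open ≡-Reasoning

  iverson : {A : Set} → Dec A → ℚ → ℚ
  iverson (yes _) v = v
  iverson (no  _) v = 0ℚ

  iverson-cong : {A B : Set} → (A → B) → (B → A) → (a : Dec A) (b : Dec B) (v : ℚ) → iverson a v ≡ iverson b v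
  iverson-cong A→B B→A (yes _) (yes _) v = refl
  iverson-cong A→B B→A (yes x) (no ¬y) v = ⊥-elim (¬y (A→B x))
  iverson-cong A→B B→A (no ¬x) (yes y) v = ⊥-elim (¬x (B→A y))
  iverson-cong A→B B→A (no _)  (no _)  v = refl

  iverson-yes : {A : Set} → A → (a : Dec A) (v : ℚ) → iverson a v ≡ v
  iverson-yes x (yes _) v = refl
  iverson-yes x (no ¬x) v = ⊥-elim (¬x x)

  iverson-no : {A : Set} → ¬ A → (a : Dec A) (v : ℚ) → iverson a v ≡ 0ℚ
  iverson-no ¬x (yes x) v = ⊥-elim (¬x x)
  iverson-no ¬x (no _)  v = refl

  iverson-*ˡ : {A : Set} (a : Dec A) (z v : ℚ) → iverson a (z * v) ≡ z * iverson a v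
  iverson-*ˡ (yes _) z v = refl
  iverson-*ˡ (no _)  z v = sym (*-zeroʳ z)

  Σ-cong : {A : Set} (xs : List A) {f g : A → ℚ} → (∀ x → f x ≡ g x) → Σ xs f ≡ Σ xs g
  Σ-cong []       f≡g = refl
  Σ-cong (x ∷ xs) f≡g = cong₂ _+_ (f≡g x) (Σ-cong xs f≡g)

  Σ-++ : {A : Set} (xs ys : List A) (f : A → ℚ) → Σ (xs ++ ys) f ≡ Σ xs f + Σ ys f
  Σ-++ []       ys f = sym (+-identityˡ _)
  Σ-++ (x ∷ xs) ys f = trans (cong (f x +_) (Σ-++ xs ys f)) (sym (+-assoc (f x) (Σ xs f) (Σ ys f)))

  Σ-concatMap : {A B : Set} (g : A → List B) (xs : List A) (f : B → ℚ) →
    Σ (concatMap g xs) f ≡ Σ xs (λ x → Σ (g x) f)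
  Σ-concatMap g []       f = refl
  Σ-concatMap g (x ∷ xs) f = trans (Σ-++ (g x) (concatMap g xs) f) (cong (Σ (g x) f +_) (Σ-concatMap g xs f))

  Σ-filter : {A : Set} {P : A → Set} (P? : Decidable P) (xs : List A) (f : A → ℚ) →
    Σ (filter P? xs) f ≡ Σ xs (λ x → iverson (P? x) (f x))
  Σ-filter P? []       f = refl
  Σ-filter P? (x ∷ xs) f with P? x
  ... | yes _ = cong (f x +_) (Σ-filter P? xs f)
  ... | no  _ = trans (Σ-filter P? xs f) (sym (+-identityˡ _))

  Σ-distrib-+ : {A : Set} (xs : List A) (f g : A → ℚ) → Σ xs (λ x → f x + g x) ≡ Σ xs f + Σ xs g
  Σ-distrib-+ []       f g = sym (+-identityˡ _)
  Σ-distrib-+ (x ∷ xs) f g = trans (cong (f x + g x +_) (Σ-distrib-+ xs f g))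
    (solve 4 (λ a b c d → (a :+ b) :+ (c :+ d) := (a :+ c) :+ (b :+ d)) refl (f x) (g x) (Σ xs f) (Σ xs g))

  *-distribˡ-Σ : {A : Set} (xs : List A) (z : ℚ) (f : A → ℚ) → Σ xs (λ x → z * f x) ≡ z * Σ xs f
  *-distribˡ-Σ []       z f = sym (*-zeroʳ z)
  *-distribˡ-Σ (x ∷ xs) z f = trans (cong (z * f x +_) (*-distribˡ-Σ xs z f)) (sym (*-distribˡ-+ z (f x) (Σ xs f)))

  pattern 0₂ = Fin.zero
  pattern 1₂ = Fin.suc Fin.zero

  Σ-allFuns-suc : ∀ n (f : (Fin (suc n) → Fin 2) → ℚ) →
    Σ (allFuns (suc n)) f ≡ Σ (allFuns n) (λ a → f (0₂ ◂ a) + f (1₂ ◂ a))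
  Σ-allFuns-suc n f = trans (Σ-concatMap _ (allFuns n) f)
    (Σ-cong (allFuns n) (λ a → cong (f (0₂ ◂ a) +_) (+-identityʳ (f (1₂ ◂ a)))))

  sum-map-+ : {A : Set} (f g : A → ℕ) (xs : List A) →
    sum (map (λ x → f x ℕ.+ g x) xs) ≡ sum (map f xs) ℕ.+ sum (map g xs)
  sum-map-+ f g []       = refl
  sum-map-+ f g (x ∷ xs) = trans (cong (f x ℕ.+ g x ℕ.+_) (sum-map-+ f g xs)) (interchange (f x) (g x) _ _)

  sum-map-allFin-suc : ∀ {n} (f : Fin (suc n) → ℕ) →
    sum (map f (allFin (suc n))) ≡ f Fin.zero ℕ.+ sum (map (f ∘ Fin.suc) (allFin n))
  sum-map-allFin-suc f = cong (λ xs → f Fin.zero ℕ.+ sum xs)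
    (trans (ListP.map-tabulate Fin.suc f) (sym (ListP.map-tabulate id (f ∘ Fin.suc))))

  count-◂ : ∀ {n} x (a : Fin n → Fin 2) → count (x ◂ a) ≡ toℕ x ℕ.+ count a
  count-◂ x a = sum-map-allFin-suc (λ i → toℕ ((x ◂ a) i))

  wsum-◂ : ∀ {n} x (a : Fin n → Fin 2) → wsum (x ◂ a) ≡ count a ℕ.+ wsum a
  wsum-◂ {n} x a = trans (sum-map-allFin-suc (λ i → toℕ i ℕ.* toℕ ((x ◂ a) i)))
    (sum-map-+ (λ i → toℕ (a i)) (λ i → toℕ i ℕ.* toℕ (a i)) (allFin n))

  weight : ℚ → ℚ → ∀ {n} → (Fin n → Fin 2) → ℚ
  weight z q a = z ^ count a * q ^ wsum a

  weight-◂ : ∀ z q {n} x (a : Fin n → Fin 2) → weight z q (x ◂ a) ≡ z ^ toℕ x * weight (z * q) q a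
  weight-◂ z q x a = begin
    z ^ count (x ◂ a) * q ^ wsum (x ◂ a)
      ≡⟨ cong₂ (λ c w → z ^ c * q ^ w) (count-◂ x a) (wsum-◂ x a) ⟩
    z ^ (toℕ x ℕ.+ count a) * q ^ (count a ℕ.+ wsum a)
      ≡⟨ cong₂ _*_ (^-homo-* z (toℕ x) (count a)) (^-homo-* q (count a) (wsum a)) ⟩
    (z ^ toℕ x * z ^ count a) * (q ^ count a * q ^ wsum a)
      ≡⟨ solve 4 (λ a b c d → (a :* b) :* (c :* d) := a :* ((b :* c) :* d)) refl
           (z ^ toℕ x) (z ^ count a) (q ^ count a) (q ^ wsum a) ⟩
    z ^ toℕ x * (z ^ count a * q ^ count a * q ^ wsum a)
      ≡⟨ cong (λ t → z ^ toℕ x * (t * q ^ wsum a)) (^-distrib-* z q (count a)) ⟨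
    z ^ toℕ x * ((z * q) ^ count a * q ^ wsum a)
      ∎
    where open ≡-Reasoning

  -- Fibonacci configurations vanishing on an initial segment

  VanishesBelow : ℕ → ∀ {n} → (Fin n → Fin 2) → Set
  VanishesBelow k a = ∀ i → toℕ i ℕ.< k → a i ≡ 0₂

  Admissible : ℕ → ℕ → ∀ n → (Fin n → Fin 2) → Set
  Admissible l k n a = IsFib l n a × VanishesBelow k a

  admissible? : ∀ l k n a → Dec (Admissible l k n a)
  admissible? l k n a = isFib? l n a ×-dec FinP.all? (λ i → (toℕ i ℕP.<? k) →-dec (a i FinP.≟ 0₂))

  vanishesBelow-tail : ∀ {n} k x (a : Fin n → Fin 2) → VanishesBelow k (x ◂ a) → VanishesBelow (k ∸ 1) a
  vanishesBelow-tail zero    x a v i ()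
  vanishesBelow-tail (suc k) x a v i i<k = v (Fin.suc i) (s≤s i<k)

  vanishesBelow-0◂ : ∀ {n} k (a : Fin n → Fin 2) → VanishesBelow (k ∸ 1) a → VanishesBelow k (0₂ ◂ a)
  vanishesBelow-0◂ k       a v Fin.zero    _         = refl
  vanishesBelow-0◂ zero    a v (Fin.suc i) ()
  vanishesBelow-0◂ (suc k) a v (Fin.suc i) (s≤s i<k) = v i i<k

  module _ {l n : ℕ} where

    isFib-tail : ∀ x (a : Fin n → Fin 2) → IsFib l (suc n) (x ◂ a) → IsFib l n a
    isFib-tail x a fib i j i≢j d≤l = fib (Fin.suc i) (Fin.suc j) (i≢j ∘ FinP.suc-injective) d≤l

    isFib-0◂ : (a : Fin n → Fin 2) → IsFib l n a → IsFib l (suc n) (0₂ ◂ a)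
    isFib-0◂ a fib Fin.zero     Fin.zero     i≢j _   = ⊥-elim (i≢j refl)
    isFib-0◂ a fib Fin.zero     (Fin.suc j)  _   _   = FinP.toℕ≤pred[n] (a j)
    isFib-0◂ a fib (Fin.suc i)  Fin.zero     _   _   = subst (ℕ._≤ 1) (sym (ℕP.+-identityʳ _)) (FinP.toℕ≤pred[n] (a i))
    isFib-0◂ a fib (Fin.suc i)  (Fin.suc j)  i≢j d≤l = fib i j (i≢j ∘ cong Fin.suc) d≤l

    isFib-1◂⇒vanishesBelow : (a : Fin n → Fin 2) → IsFib l (suc n) (1₂ ◂ a) → VanishesBelow l a
    isFib-1◂⇒vanishesBelow a fib i i<l with a i | fib Fin.zero (Fin.suc i) (λ ()) i<l
    ... | 0₂ | _       = refl
    ... | 1₂ | s≤s ()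

    isFib-1◂ : (a : Fin n → Fin 2) → IsFib l n a → VanishesBelow l a → IsFib l (suc n) (1₂ ◂ a)
    isFib-1◂ a fib v Fin.zero    Fin.zero    i≢j _   = ⊥-elim (i≢j refl)
    isFib-1◂ a fib v Fin.zero    (Fin.suc j) _   j<l rewrite v j j<l = s≤s z≤n
    isFib-1◂ a fib v (Fin.suc i) Fin.zero    _   i<l rewrite v i i<l = s≤s z≤n
    isFib-1◂ a fib v (Fin.suc i) (Fin.suc j) i≢j d≤l = fib i j (i≢j ∘ cong Fin.suc) d≤l


  admissibleWeight : ℕ → ℕ → ℚ → ℚ → ∀ {n} → (Fin n → Fin 2) → ℚ
  admissibleWeight l k z q {n} a = iverson (admissible? l k n a) (weight z q a)

  restrictedχ : ℕ → ℕ → ℕ → ℚ → ℚ → ℚ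
  restrictedχ l k n z q = Σ (allFuns n) (admissibleWeight l k z q)

  module _ (l : ℕ) (z q : ℚ) {n : ℕ} (a : Fin n → Fin 2) where

    admissibleWeight-0◂ : ∀ k → admissibleWeight l k z q (0₂ ◂ a) ≡ admissibleWeight l (k ∸ 1) (z * q) q a
    admissibleWeight-0◂ k = trans
      (cong (iverson (admissible? l k (suc n) (0₂ ◂ a))) (trans (weight-◂ z q 0₂ a) (*-identityˡ _)))
      (iverson-cong (λ (fib , v) → isFib-tail {l} 0₂ a fib , vanishesBelow-tail k 0₂ a v)
                    (λ (fib , v) → isFib-0◂ {l} a fib , vanishesBelow-0◂ k a v)
                    (admissible? l k (suc n) (0₂ ◂ a)) (admissible? l (k ∸ 1) n a) _)

    admissibleWeight-1◂-forced : ∀ k → admissibleWeight l (suc k) z q (1₂ ◂ a) ≡ 0ℚ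
    admissibleWeight-1◂-forced k =
      iverson-no (λ (_ , v) → 1₂≢0₂ (v Fin.zero ℕ.z<s)) (admissible? l (suc k) (suc n) (1₂ ◂ a)) _
      where
      1₂≢0₂ : 1₂ ≢ 0₂
      1₂≢0₂ ()

    admissibleWeight-1◂-free : admissibleWeight l 0 z q (1₂ ◂ a) ≡ z * admissibleWeight l l (z * q) q a
    admissibleWeight-1◂-free = begin
      iverson (admissible? l 0 (suc n) (1₂ ◂ a)) (weight z q (1₂ ◂ a))
        ≡⟨ cong (iverson (admissible? l 0 (suc n) (1₂ ◂ a)))
             (trans (weight-◂ z q 1₂ a) (cong (_* weight (z * q) q a) (*-identityʳ z))) ⟩
      iverson (admissible? l 0 (suc n) (1₂ ◂ a)) (z * weight (z * q) q a)
        ≡⟨ iverson-cong (λ (fib , _) → isFib-tail {l} 1₂ a fib , isFib-1◂⇒vanishesBelow {l} a fib)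
                        (λ (fib , v) → isFib-1◂ {l} a fib v , λ _ ())
                        (admissible? l 0 (suc n) (1₂ ◂ a)) (admissible? l l n a) _ ⟩
      iverson (admissible? l l n a) (z * weight (z * q) q a)
        ≡⟨ iverson-*ˡ (admissible? l l n a) z _ ⟩
      z * admissibleWeight l l (z * q) q a
        ∎
      where open ≡-Reasoning

  χ≡restrictedχ : ∀ l n z q → χ l n z q ≡ restrictedχ l 0 n z q
  χ≡restrictedχ l n z q = trans (Σ-filter (isFib? l n) (allFuns n) (weight z q))
    (Σ-cong (allFuns n) (λ a → iverson-cong (_, λ _ ()) proj₁ (isFib? l n a) (admissible? l 0 n a) _))

  restrictedχ-[] : ∀ l k z q → restrictedχ l k 0 z q ≡ 1ℚ
  restrictedχ-[] l k z q = cong (_+ 0ℚ) (iverson-yes ((λ ()) , (λ ())) (admissible? l k 0 (λ ())) (weight z q {0} (λ ())))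

  restrictedχ-forced : ∀ l k n z q → restrictedχ l (suc k) (suc n) z q ≡ restrictedχ l k n (z * q) q
  restrictedχ-forced l k n z q = trans (Σ-allFuns-suc n (admissibleWeight l (suc k) z q))
    (Σ-cong (allFuns n) {g = admissibleWeight l k (z * q) q} (λ a → trans (cong₂ _+_ (admissibleWeight-0◂ l z q a (suc k))
                                                (admissibleWeight-1◂-forced l z q a k))
                                     (+-identityʳ _)))

  restrictedχ-free : ∀ l n z q →
    restrictedχ l 0 (suc n) z q ≡ restrictedχ l 0 n (z * q) q + z * restrictedχ l l n (z * q) q
  restrictedχ-free l n z q = begin
    restrictedχ l 0 (suc n) z q
      ≡⟨ Σ-allFuns-suc n (admissibleWeight l 0 z q) ⟩
    Σ (allFuns n) (λ a → admissibleWeight l 0 z q (0₂ ◂ a) + admissibleWeight l 0 z q (1₂ ◂ a))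
      ≡⟨ Σ-cong (allFuns n) (λ a → cong₂ _+_ (admissibleWeight-0◂ l z q a 0) (admissibleWeight-1◂-free l z q a)) ⟩
    Σ (allFuns n) (λ a → admissibleWeight l 0 (z * q) q a + z * admissibleWeight l l (z * q) q a)
      ≡⟨ Σ-distrib-+ (allFuns n) (admissibleWeight l 0 (z * q) q) (λ a → z * admissibleWeight l l (z * q) q a) ⟩
    restrictedχ l 0 n (z * q) q + Σ (allFuns n) (λ a → z * admissibleWeight l l (z * q) q a)
      ≡⟨ cong (restrictedχ l 0 n (z * q) q +_) (*-distribˡ-Σ (allFuns n) z (admissibleWeight l l (z * q) q)) ⟩
    restrictedχ l 0 n (z * q) q + z * restrictedχ l l n (z * q) q
      ∎
    where open ≡-Reasoning

  module _ {q : ℚ} (q≢1 : q ≢ 1ℚ) (q≢-1 : q ≢ - 1ℚ) (l : ℕ) where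

    restrictedχ≡P : ∀ n k r → k ℕ.+ r ≡ l → ∀ z → restrictedχ l k n z q ≡ P l (n ℕ.+ r) (z * q ^ k) q
    restrictedχ≡P zero k r k+r≡l z =
      trans (restrictedχ-[] l k z q) (sym (P≡1 q≢1 q≢-1 l r _ (subst (r ℕ.≤_) k+r≡l (ℕP.m≤n+m r k))))
    restrictedχ≡P (suc n) (suc k) r 1+k+r≡l z = begin
      restrictedχ l (suc k) (suc n) z q
        ≡⟨ restrictedχ-forced l k n z q ⟩
      restrictedχ l k n (z * q) q
        ≡⟨ restrictedχ≡P n k (suc r) (trans (ℕP.+-suc k r) 1+k+r≡l) (z * q) ⟩
      P l (n ℕ.+ suc r) (z * q * q ^ k) q
        ≡⟨ cong₂ (λ N w → P l N w q) (ℕP.+-suc n r) (*-assoc z q (q ^ k)) ⟩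
      P l (suc n ℕ.+ r) (z * q ^ suc k) q
        ∎
      where open ≡-Reasoning
    restrictedχ≡P (suc n) zero .l refl z = begin
      restrictedχ l 0 (suc n) z q
        ≡⟨ restrictedχ-free l n z q ⟩
      restrictedχ l 0 n (z * q) q + z * restrictedχ l l n (z * q) q
        ≡⟨ cong₂ (λ u v → u + z * v) (restrictedχ≡P n 0 l refl (z * q)) (restrictedχ≡P n l 0 (ℕP.+-identityʳ l) (z * q)) ⟩
      P l (n ℕ.+ l) (z * q * 1ℚ) q + z * P l (n ℕ.+ 0) (z * q * q ^ l) q
        ≡⟨ cong₂ (λ u v → P l (n ℕ.+ l) u q + z * v) (*-identityʳ (z * q))
             (cong₂ (λ N w → P l N w q) (trans (ℕP.+-identityʳ n) (sym (ℕP.m+n∸n≡m n l))) (*-assoc z q (q ^ l))) ⟩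
      P l (n ℕ.+ l) (z * q) q + z * P l (n ℕ.+ l ∸ l) (z * q ^ suc l) q
        ≡⟨ P-suc q≢1 q≢-1 l (n ℕ.+ l) z (ℕP.m≤n+m l n) ⟨
      P l (suc n ℕ.+ l) z q
        ≡⟨ cong (λ w → P l (suc n ℕ.+ l) w q) (*-identityʳ z) ⟨
      P l (suc n ℕ.+ l) (z * 1ℚ) q
        ∎
      where open ≡-Reasoning

open import Data.Nat using (ℕ; _+_)
open import Data.Rational using (ℚ; 1ℚ; -_; _*_)
open import Data.Rational.Properties using (*-identityʳ)
open import Relation.Binary.PropositionalEquality using (_≡_; _≢_; refl; cong; module ≡-Reasoning)

mainTheorem1 : (l n : ℕ) (z q : ℚ) → q ≢ 1ℚ → q ≢ - 1ℚ →
    χ l n z q ≡ P l (n + l) z q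
mainTheorem1 l n z q q≢1 q≢-1 = begin
  χ l n z q              ≡⟨ χ≡restrictedχ l n z q ⟩
  restrictedχ l 0 n z q  ≡⟨ restrictedχ≡P q≢1 q≢-1 l n 0 l refl z ⟩
  P l (n + l) (z * 1ℚ) q ≡⟨ cong (λ w → P l (n + l) w q) (*-identityʳ z) ⟩
  P l (n + l) z q        ∎
  where open ≡-Reasoning
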